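{- Let $i\ge 7$ and let $U$ be the prefix of $F_{i-3}$ of length $f_{i-3}-1$. Then every occurrence of $U$ in $F_i$ that is followed by a character is followed by the character $F_{i-3}[f_{i-3}]$; that is, if $Ux$ occurs in $F_i$ for a character $x$, then $x=F_{i-3}[f_{i-3}]$.
   Context: Fibonacci words: $F_1=\texttt{b}$, $F_2=\texttt{a}$, $F_k=F_{k-1}F_{k-2}$ for $k\ge 3$; $f_k=|F_k|$. $S[m]$ denotes the $m$-th character of $S$ (1-indexed). -}

module Defs where

open import Data.Nat using (ℕ; zero; suc)
open import Data.List using (List; []; _∷_; _++_; [_])

data Letter : Set where
  a b : Letter

-- Fibonacci words: F 1 = b, F 2 = a, F k = F (k-1) F (k-2) for k ≥ 3.
-- F 0 is an unused placeholder (the paper indexes from 1).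
F : ℕ → List Letter
F zero = []
F (suc zero) = [ b ]
F (suc (suc zero)) = [ a ]
F (suc (suc (suc k))) = F (suc (suc k)) ++ F (suc k)

{-# OPTIONS --safe #-}
-- The Fibonacci words are the iterates of the morphism φ : a ↦ ab, b ↦ a, so they
-- contain neither bb nor aaa: a four-state automaton recognising such words is mapped
-- into itself by φ.  Since F (k + 2) ends with F k, every F k with k ≥ 4 ends in ba or
-- aab.  Hence U ends in b or in aa, and a letter following U other than the last letter
-- of F (i ∸ 3) would create bb or aaa.
module Submission where

open import Defs
open import Data.Nat using (ℕ; _≤_; _∸_; _+_; suc; s≤s; z≤n)
open import Data.Nat.Properties using (m+n∸n≡m)
open import Data.List using (List; []; _∷_; _++_; [_]; _∷ʳ_; take; length; last; concatMap)
open import Data.List.Properties using (++-assoc; length-++; concatMap-++)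
open import Data.Maybe using (just)
open import Data.Product using (Σ; ∃₂; _×_; _,_)
open import Data.Unit using (⊤)
open import Data.Empty using (⊥; ⊥-elim)
open import Relation.Nullary using (¬_)
open import Relation.Binary.PropositionalEquality
  using (_≡_; refl; sym; trans; cong; subst; module ≡-Reasoning)
open ≡-Reasoning

take-length-++ : ∀ {A : Set} (xs ys : List A) → take (length xs) (xs ++ ys) ≡ xs
take-length-++ []       ys = refl
take-length-++ (x ∷ xs) ys = cong (x ∷_) (take-length-++ xs ys)

take-init-∷ʳ : ∀ {A : Set} (xs : List A) y → take (length (xs ∷ʳ y) ∸ 1) (xs ∷ʳ y) ≡ xs
take-init-∷ʳ xs y = begin
  take (length (xs ∷ʳ y) ∸ 1) (xs ∷ʳ y)   ≡⟨ cong (λ n → take (n ∸ 1) (xs ∷ʳ y)) (length-++ xs) ⟩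
  take (length xs + 1 ∸ 1) (xs ∷ʳ y)      ≡⟨ cong (λ n → take n (xs ∷ʳ y)) (m+n∸n≡m (length xs) 1) ⟩
  take (length xs) (xs ∷ʳ y)              ≡⟨ take-length-++ xs [ y ] ⟩
  xs                                      ∎

last-∷ʳ : ∀ {A : Set} (xs : List A) y → last (xs ∷ʳ y) ≡ just y
last-∷ʳ []           y = refl
last-∷ʳ (x ∷ [])     y = refl
last-∷ʳ (x ∷ x′ ∷ xs) y = last-∷ʳ (x′ ∷ xs) y

φ : List Letter → List Letter
φ = concatMap image
  where
  image : Letter → List Letter
  image a = a ∷ b ∷ []
  image b = [ a ]

φ-F : ∀ k → φ (F (suc k)) ≡ F (suc (suc k))
φ-F 0             = refl
φ-F 1             = refl
φ-F (suc (suc k)) = begin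
  φ (F (2 + k) ++ F (1 + k))     ≡⟨ concatMap-++ _ (F (2 + k)) (F (1 + k)) ⟩
  φ (F (2 + k)) ++ φ (F (1 + k)) ≡⟨ cong (_++ φ (F (1 + k))) (φ-F (suc k)) ⟩
  F (3 + k) ++ φ (F (1 + k))     ≡⟨ cong (F (3 + k) ++_) (φ-F k) ⟩
  F (3 + k) ++ F (2 + k)         ∎

-- Admissible t w: the word w, read after a word ending in the tail t, creates no
-- factor bb or aaa.  The tail ·a means "ends in a but not in aa".
data Tail : Set where
  ε ·b ·a ·aa : Tail

Admissible : Tail → List Letter → Set
Admissible _   []      = ⊤
Admissible ·b  (b ∷ w) = ⊥
Admissible _   (b ∷ w) = Admissible ·b w
Admissible ·aa (a ∷ w) = ⊥
Admissible ·a  (a ∷ w) = Admissible ·aa w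
Admissible _   (a ∷ w) = Admissible ·a w

¬admissible-bb : ∀ t {w} → ¬ Admissible t (b ∷ b ∷ w)
¬admissible-bb ε   ()
¬admissible-bb ·b  ()
¬admissible-bb ·a  ()
¬admissible-bb ·aa ()

¬admissible-aaa : ∀ t {w} → ¬ Admissible t (a ∷ a ∷ a ∷ w)
¬admissible-aaa ε   ()
¬admissible-aaa ·b  ()
¬admissible-aaa ·a  ()
¬admissible-aaa ·aa ()

admissible-∷ : ∀ t x w → Admissible t (x ∷ w) → Σ Tail λ t′ → Admissible t′ w
admissible-∷ ε   a w adm = ·a , adm
admissible-∷ ·b  a w adm = ·a , adm
admissible-∷ ·a  a w adm = ·aa , adm
admissible-∷ ε   b w adm = ·b , adm
admissible-∷ ·a  b w adm = ·b , adm
admissible-∷ ·aa b w adm = ·b , adm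

admissible-++ : ∀ t u {w} → Admissible t (u ++ w) → Σ Tail λ t′ → Admissible t′ w
admissible-++ t []      adm = t , adm
admissible-++ t (x ∷ u) adm with admissible-∷ t x (u ++ _) adm
... | t′ , adm′ = admissible-++ t′ u adm′

admissible-infix : ∀ t P V W {S} → Admissible t (P ++ (V ++ W) ++ S) →
                   Σ Tail λ t′ → Admissible t′ (W ++ S)
admissible-infix t P V W {S} adm with admissible-++ t P adm
... | t′ , adm′ = admissible-++ t′ V (subst (Admissible t′) (++-assoc V W S) adm′)

φ-tail : Tail → Tail
φ-tail ε   = ε
φ-tail ·b  = ·a
φ-tail ·a  = ·b
φ-tail ·aa = ·b

admissible-φ : ∀ t w → Admissible t w → Admissible (φ-tail t) (φ w)
admissible-φ t   []      _   = _
admissible-φ ε   (a ∷ w) adm = admissible-φ ·a w adm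
admissible-φ ·b  (a ∷ w) adm = admissible-φ ·a w adm
admissible-φ ·a  (a ∷ w) adm = admissible-φ ·aa w adm
admissible-φ ε   (b ∷ w) adm = admissible-φ ·b w adm
admissible-φ ·a  (b ∷ w) adm = admissible-φ ·b w adm
admissible-φ ·aa (b ∷ w) adm = admissible-φ ·b w adm

admissible-F : ∀ k → Admissible ε (F k)
admissible-F 0       = _
admissible-F 1       = _
admissible-F (suc (suc k)) =
  subst (Admissible ε) (φ-F k) (admissible-φ ε (F (suc k)) (admissible-F (suc k)))

data Forces : List Letter → Letter → Set where
  after-b  : ∀ V → Forces (V ∷ʳ b) a
  after-aa : ∀ V → Forces (V ++ a ∷ a ∷ []) b

forces-++ˡ : ∀ Z {U y} → Forces U y → Forces (Z ++ U) y
forces-++ˡ Z (after-b V)  = subst (λ U → Forces U a) (++-assoc Z V _) (after-b (Z ++ V))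
forces-++ˡ Z (after-aa V) = subst (λ U → Forces U b) (++-assoc Z V _) (after-aa (Z ++ V))

forces-next : ∀ {t} P {U y x S} → Forces U y → Admissible t (P ++ U ++ x ∷ S) → x ≡ y
forces-next P {x = a} (after-b V) _ = refl
forces-next {t} P {x = b} (after-b V) adm with admissible-infix t P V [ b ] adm
... | t′ , adm-bb = ⊥-elim (¬admissible-bb t′ adm-bb)
forces-next P {x = b} (after-aa V) _ = refl
forces-next {t} P {x = a} (after-aa V) adm with admissible-infix t P V (a ∷ a ∷ []) adm
... | t′ , adm-aaa = ⊥-elim (¬admissible-aaa t′ adm-aaa)

F-forces-last : ∀ m → ∃₂ λ U y → Forces U y × F (4 + m) ≡ U ∷ʳ y
F-forces-last 0 = a ∷ b ∷ [] , a , after-b [ a ] , refl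
F-forces-last 1 = a ∷ b ∷ a ∷ a ∷ [] , b , after-aa (a ∷ b ∷ []) , refl
F-forces-last (suc (suc m)) with F-forces-last m
... | U , y , forces , F≡U∷ʳy =
  F (5 + m) ++ U , y , forces-++ˡ (F (5 + m)) forces ,
  trans (cong (F (5 + m) ++_) F≡U∷ʳy) (sym (++-assoc (F (5 + m)) U [ y ]))

lemma30 : (i : ℕ) → 7 ≤ i →
    (P S : List Letter) (x : Letter) →
    F i ≡ P ++ (take (length (F (i ∸ 3)) ∸ 1) (F (i ∸ 3)) ++ (x ∷ S)) →
    last (F (i ∸ 3)) ≡ just x
lemma30 (suc (suc (suc (suc (suc (suc (suc m))))))) (s≤s (s≤s (s≤s (s≤s (s≤s (s≤s (s≤s z≤n)))))))
        P S x occurrence with F-forces-last m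
... | U , y , forces , F≡U∷ʳy = begin
  last (F (4 + m)) ≡⟨ cong last F≡U∷ʳy ⟩
  last (U ∷ʳ y)    ≡⟨ last-∷ʳ U y ⟩
  just y           ≡⟨ cong just (sym (forces-next P forces admissible-occurrence)) ⟩
  just x           ∎
  where
  init-F≡U : take (length (F (4 + m)) ∸ 1) (F (4 + m)) ≡ U
  init-F≡U = trans (cong (λ W → take (length W ∸ 1) W) F≡U∷ʳy) (take-init-∷ʳ U y)

  admissible-occurrence : Admissible ε (P ++ U ++ x ∷ S)
  admissible-occurrence =
    subst (Admissible ε) (trans occurrence (cong (λ W → P ++ W ++ x ∷ S) init-F≡U))
          (admissible-F (7 + m))
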